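{- Let $k\geq 1$ and $1\leq a\leq k$ be integers, and let $$P_{k,a}(x,q)=\sum_{n\geq k}\sum_{\pi\in P_{n,k}}x^nq^{\mathrm{sumelements}_a(\pi)}.$$ Then $$P_{k,a}(x,q)=x^kq^{\frac{a(a-1)}{2}}\left(\prod_{j=1}^{a-1}\frac{1}{1-xq\frac{1-q^j}{1-q}}\right)\left(\prod_{i=a}^{k}\frac{1}{1-ix}\right).$$
   Context: A set partition of $[n]=\{1,\dots,n\}$ with exactly $k$ blocks is a collection $\{B_1,\dots,B_k\}$ of nonempty pairwise disjoint subsets with union $[n]$, the blocks indexed so that $\min B_1<\min B_2<\cdots<\min B_k$. $P_{n,k}$ denotes the set of all such partitions. A partition is identified with its canonical sequential form, the word $\pi=\pi_1\pi_2\cdots\pi_n$ with $i\in B_{\pi_i}$ for all $i$. An entry $\pi_i$ is a record if $\pi_i>\pi_j$ for all $j<i$; in canonical sequential form the records are exactly the first occurrences of the letters $1,2,\dots,k$. For a letter $a\in[k]$, $\mathrm{sumelements}_a(\pi)$ is the sum of all entries $\pi_j$ that precede (i.e. lie at positions strictly before) the record $a$ in $\pi$. For example, for $\pi=121132$, $\mathrm{sumelements}_2(\pi)=1$ and $\mathrm{sumelements}_3(\pi)=1+2+1+1=5$. -}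

module Defs where

open import Data.Bool using (Bool; true; false; _∧_; if_then_else_)
open import Data.Nat using (ℕ; zero; suc; _+_; _*_; _∸_; _≡ᵇ_; _≤ᵇ_; _⊔_)
open import Data.List using (List; []; _∷_; map; upTo; concatMap; filterᵇ; length; foldr)
open import Data.Nat.ListAction using (sum)
open import Data.Bool.ListAction using (any)

words : ℕ → ℕ → List (List ℕ)
words k zero    = [] ∷ []
words k (suc n) = concatMap (λ x → map (x ∷_) (words k n)) (map suc (upTo k))

-- restricted growth condition: each letter is ≥ 1 and at most 1 + (max of
-- the previous letters); i.e. records are the first occurrences of 1,2,…
rgsFrom : ℕ → List ℕ → Bool
rgsFrom mx []       = true
rgsFrom mx (x ∷ xs) = (1 ≤ᵇ x) ∧ (x ≤ᵇ suc mx) ∧ rgsFrom (mx ⊔ x) xs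

isCanonical : List ℕ → Bool
isCanonical = rgsFrom 0

occurs : ℕ → List ℕ → Bool
occurs k = any (λ y → y ≡ᵇ k)

-- canonical sequential form of a partition of [n] with exactly k blocks
-- (letters in {1..k}, restricted growth, and the letter k occurs)
inPnk : ℕ → List ℕ → Bool
inPnk k w = isCanonical w ∧ occurs k w

P : ℕ → ℕ → List (List ℕ)
P n k = filterᵇ (inPnk k) (words k n)

sumelements : ℕ → List ℕ → ℕ
sumelements a []       = 0
sumelements a (x ∷ xs) = if x ≡ᵇ a then 0 else x + sumelements a xs

-- Formal power series in x, q with ℕ coefficients:
-- f n m = coefficient of x^n q^m

Series : Set
Series = ℕ → ℕ → ℕ

sumTo : ℕ → (ℕ → ℕ) → ℕ
sumTo n f = sum (map f (upTo (suc n)))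

_⊛_ : Series → Series → Series
(f ⊛ g) n m = sumTo n (λ i → sumTo m (λ j → f i j * g (n ∸ i) (m ∸ j)))

mono : ℕ → ℕ → Series
mono i j n m = if (n ≡ᵇ i) ∧ (m ≡ᵇ j) then 1 else 0

one : Series
one = mono 0 0

scale : ℕ → Series → Series
scale c f n m = c * f n m

pow : Series → ℕ → Series
pow f zero    = one
pow f (suc t) = f ⊛ pow f t

-- 1/(1 - f) = Σ_t f^t, for f with no x^0 terms (then only t ≤ n
-- contribute to the coefficient of x^n)
geom : Series → Series
geom f n m = sumTo n (λ t → pow f t n m)

prodS : List Series → Series
prodS = foldr _⊛_ one

-- [j]_q = (1 - q^j)/(1 - q) = 1 + q + … + q^{j-1}
qint : ℕ → Series
qint j n m = if (n ≡ᵇ 0) ∧ (suc m ≤ᵇ j) then 1 else 0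

-- P_{k,a}(x,q): coefficient of x^n q^m is #{π ∈ P_{n,k} : sumelements_a π = m}
-- (for n < k, P_{n,k} is empty, so summing over all n equals summing over n ≥ k)
Pka : ℕ → ℕ → Series
Pka k a n m = length (filterᵇ (λ w → sumelements a w ≡ᵇ m) (P n k))

{-# OPTIONS --safe #-}
-- Read a canonical word from left to right, keeping track of its current maximum. While the
-- maximum mx is below a, the next letter is an old letter l ≤ mx, of weight x q^l since it adds l
-- to sumelements_a (together x q [mx]_q), or the new record mx + 1, of weight x q^(mx+1), or, when
-- mx + 1 = a, the record a itself, after which the q-exponent is frozen. With maximum j ≥ a the
-- old letters have weight j x together and a new record has weight x. So the generating series
-- S_mx and C_j of the continuations of such a prefix satisfy
--   S_mx = x q [mx]_q S_mx + x q^(mx+1) S_(mx+1),   S_(a-1) = x q [a-1]_q S_(a-1) + x C_a,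
--   C_j  = j x C_j + x C_(j+1),                     C_k     = k x C_k + 1.
-- The coefficient of the unknown is divisible by x, so each equation X = f X + g has the unique
-- solution X = g / (1 - f). Unwinding from C_k down to P_{k,a} = S_0 multiplies the factors
-- 1/(1 - x q [j]_q) and 1/(1 - i x), and the monomials collect to x^k q^(1 + ⋯ + (a-1)).

module Submission where

open import Defs
open import Data.Bool using (Bool; true; false; _∧_; _∨_; if_then_else_; T; T?)
open import Data.Bool.Properties using (T-≡; ∧-zeroʳ; if-∧)
open import Data.Nat
open import Data.Nat.Properties
open import Data.Nat.DivMod using (_/_; m*n/n≡m)
open import Data.Nat.Induction using (<-rec)
open import Data.Nat.ListAction using (sum)
open import Data.Nat.Solver using (module +-*-Solver)
open import Data.List using (List; []; _∷_; _++_; map; upTo; applyUpTo; concatMap; filterᵇ; length)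
open import Data.List.Properties using (map-applyUpTo; length-++; filter-++)
open import Data.Product using (_,_)
open import Data.Sum using (inj₁; inj₂)
open import Function using (id; _∘_; Equivalence)
open import Level using (0ℓ)
open import Relation.Nullary using (¬_; contradiction)
open import Relation.Binary.Bundles using (Setoid)
open import Relation.Binary.Structures using (IsEquivalence)
open import Relation.Binary.PropositionalEquality
open import Algebra.Structures using (IsCommutativeMonoid)
open import Algebra.Bundles using (CommutativeMonoid)
open import Algebra.Properties.CommutativeSemigroup +-commutativeSemigroup
  using () renaming (interchange to +-interchange)

∑< : ℕ → (ℕ → ℕ) → ℕ
∑< zero    f = 0
∑< (suc n) f = f 0 + ∑< n (f ∘ suc)

sum-applyUpTo : ∀ n (f : ℕ → ℕ) → sum (applyUpTo f n) ≡ ∑< n f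
sum-applyUpTo zero    f = refl
sum-applyUpTo (suc n) f = cong (f 0 +_) (sum-applyUpTo n (f ∘ suc))

∑<-cong : ∀ n {f g : ℕ → ℕ} → (∀ i → i < n → f i ≡ g i) → ∑< n f ≡ ∑< n g
∑<-cong zero    f≗g = refl
∑<-cong (suc n) f≗g = cong₂ _+_ (f≗g 0 z<s) (∑<-cong n (λ i i<n → f≗g (suc i) (s<s i<n)))

∑<-zero : ∀ n {f : ℕ → ℕ} → (∀ i → i < n → f i ≡ 0) → ∑< n f ≡ 0
∑<-zero zero    f≗0 = refl
∑<-zero (suc n) f≗0 = cong₂ _+_ (f≗0 0 z<s) (∑<-zero n (λ i i<n → f≗0 (suc i) (s<s i<n)))

∑<-const : ∀ n c → ∑< n (λ _ → c) ≡ n * c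
∑<-const zero    c = refl
∑<-const (suc n) c = cong (c +_) (∑<-const n c)

∑<-+ : ∀ n (f g : ℕ → ℕ) → ∑< n (λ i → f i + g i) ≡ ∑< n f + ∑< n g
∑<-+ zero    f g = refl
∑<-+ (suc n) f g = trans (cong (f 0 + g 0 +_) (∑<-+ n (f ∘ suc) (g ∘ suc)))
                         (+-interchange (f 0) (g 0) _ _)

*-distribˡ-∑< : ∀ n c (f : ℕ → ℕ) → c * ∑< n f ≡ ∑< n (λ i → c * f i)
*-distribˡ-∑< zero    c f = *-zeroʳ c
*-distribˡ-∑< (suc n) c f =
  trans (*-distribˡ-+ c (f 0) _) (cong (c * f 0 +_) (*-distribˡ-∑< n c (f ∘ suc)))

*-distribʳ-∑< : ∀ n c (f : ℕ → ℕ) → ∑< n f * c ≡ ∑< n (λ i → f i * c)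
*-distribʳ-∑< n c f = trans (*-comm (∑< n f) c)
  (trans (*-distribˡ-∑< n c f) (∑<-cong n (λ i _ → *-comm c (f i))))

∑<-comm : ∀ m n (F : ℕ → ℕ → ℕ) → ∑< m (λ i → ∑< n (F i)) ≡ ∑< n (λ j → ∑< m (λ i → F i j))
∑<-comm zero    n F = sym (∑<-zero n (λ _ _ → refl))
∑<-comm (suc m) n F = trans (cong (∑< n (F 0) +_) (∑<-comm m n (F ∘ suc)))
                            (sym (∑<-+ n (F 0) _))

∑<-snoc : ∀ n (f : ℕ → ℕ) → ∑< (suc n) f ≡ ∑< n f + f n
∑<-snoc zero    f = +-identityʳ (f 0)
∑<-snoc (suc n) f = trans (cong (f 0 +_) (∑<-snoc n (f ∘ suc))) (sym (+-assoc (f 0) _ _))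

∑<-vanishing-tail : ∀ {j k} (f : ℕ → ℕ) → j ≤ k → (∀ i → j ≤ i → i < k → f i ≡ 0) →
                    ∑< k f ≡ ∑< j f
∑<-vanishing-tail {zero}  {k}     f _         f≗0 = ∑<-zero k (λ i → f≗0 i z≤n)
∑<-vanishing-tail {suc j} {suc k} f (s≤s j≤k) f≗0 = cong (f 0 +_)
  (∑<-vanishing-tail (f ∘ suc) j≤k (λ i j≤i i<k → f≗0 (suc i) (s≤s j≤i) (s<s i<k)))

∑<-reverse : ∀ n (f : ℕ → ℕ) → ∑< (suc n) (λ i → f (n ∸ i)) ≡ ∑< (suc n) f
∑<-reverse zero    f = refl
∑<-reverse (suc n) f = begin
  f (suc n) + ∑< (suc n) (λ i → f (n ∸ i)) ≡⟨ cong (f (suc n) +_) (∑<-reverse n f) ⟩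
  f (suc n) + ∑< (suc n) f                  ≡⟨ +-comm (f (suc n)) _ ⟩
  ∑< (suc n) f + f (suc n)                  ≡⟨ ∑<-snoc (suc n) f ⟨
  ∑< (suc (suc n)) f                        ∎
  where open ≡-Reasoning

∑<-triangle : ∀ n (F : ℕ → ℕ → ℕ) →
  ∑< (suc n) (λ i → ∑< (suc i) (λ i′ → F i′ i)) ≡
  ∑< (suc n) (λ i′ → ∑< (suc (n ∸ i′)) (λ u → F i′ (i′ + u)))
∑<-triangle zero    F = refl
∑<-triangle (suc n) F = begin
  (F 0 0 + 0) + ∑< (suc n) (λ i → first i + rest i)
    ≡⟨ cong₂ _+_ (+-identityʳ (F 0 0)) (∑<-+ (suc n) first rest) ⟩
  F 0 0 + (∑< (suc n) first + ∑< (suc n) rest)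
    ≡⟨ +-assoc (F 0 0) _ _ ⟨
  (F 0 0 + ∑< (suc n) first) + ∑< (suc n) rest
    ≡⟨ cong (F 0 0 + ∑< (suc n) first +_) (∑<-triangle n (λ i′ i → F (suc i′) (suc i))) ⟩
  (F 0 0 + ∑< (suc n) first) + ∑< (suc n) (λ i′ → ∑< (suc (n ∸ i′)) (λ u → F (suc i′) (suc (i′ + u))))
    ∎
  where
  open ≡-Reasoning
  first rest : ℕ → ℕ
  first i = F 0 (suc i)
  rest  i = ∑< (suc i) (λ i′ → F (suc i′) (suc i))

∑<-delta : ∀ n i (v : ℕ → ℕ) → ∑< n (λ l → if l ≡ᵇ i then v l else 0) ≡ (if i <ᵇ n then v i else 0)
∑<-delta zero    i       v = refl
∑<-delta (suc n) zero    v = trans (cong (v 0 +_) (∑<-zero n (λ _ _ → refl))) (+-identityʳ (v 0))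
∑<-delta (suc n) (suc i) v = ∑<-delta n i (v ∘ suc)

∑<-truncate : ∀ a b (f : ℕ → ℕ) → ∑< a (λ l → if l <ᵇ b then f l else 0) ≡ ∑< (a ⊓ b) f
∑<-truncate zero    b       f = refl
∑<-truncate (suc a) zero    f = ∑<-zero a (λ _ _ → refl)
∑<-truncate (suc a) (suc b) f = cong (f 0 +_) (∑<-truncate a b (f ∘ suc))


T⇒≡true : ∀ {b} → T b → b ≡ true
T⇒≡true = Equivalence.to T-≡

¬T⇒≡false : ∀ {b} → ¬ T b → b ≡ false
¬T⇒≡false {false} _  = refl
¬T⇒≡false {true}  ¬t = contradiction _ ¬t

≡ᵇ-refl : ∀ n → (n ≡ᵇ n) ≡ true
≡ᵇ-refl n = T⇒≡true (≡⇒≡ᵇ n n refl)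

≢⇒≡ᵇ-false : ∀ {m n} → m ≢ n → (m ≡ᵇ n) ≡ false
≢⇒≡ᵇ-false {m} {n} m≢n = ¬T⇒≡false (m≢n ∘ ≡ᵇ⇒≡ m n)

≡ᵇ-sym : ∀ m n → (m ≡ᵇ n) ≡ (n ≡ᵇ m)
≡ᵇ-sym zero    zero    = refl
≡ᵇ-sym zero    (suc n) = refl
≡ᵇ-sym (suc m) zero    = refl
≡ᵇ-sym (suc m) (suc n) = ≡ᵇ-sym m n

+-≡ᵇ : ∀ x s m → (x + s ≡ᵇ m) ≡ (if x <ᵇ suc m then (s ≡ᵇ m ∸ x) else false)
+-≡ᵇ zero    s m       = refl
+-≡ᵇ (suc x) s zero    = refl
+-≡ᵇ (suc x) s (suc m) = +-≡ᵇ x s m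

indicator-* : ∀ b y → (if b then 1 else 0) * y ≡ (if b then y else 0)
indicator-* true  y = +-identityʳ y
indicator-* false y = refl


-- Formal power series in x and q

infix 4 _≈_
_≈_ : Series → Series → Set
f ≈ g = ∀ n m → f n m ≡ g n m

≈-isEquivalence : IsEquivalence _≈_
≈-isEquivalence = record
  { refl  = λ _ _ → refl
  ; sym   = λ f≈g n m → sym (f≈g n m)
  ; trans = λ f≈g g≈h n m → trans (f≈g n m) (g≈h n m)
  }

≈-setoid : Setoid 0ℓ 0ℓ
≈-setoid = record { isEquivalence = ≈-isEquivalence }

open IsEquivalence ≈-isEquivalence
  using () renaming (refl to ≈-refl; sym to ≈-sym; trans to ≈-trans)

infixl 6 _⊕_
_⊕_ : Series → Series → Series
(f ⊕ g) n m = f n m + g n m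

⊕-cong : ∀ {f f′ g g′} → f ≈ f′ → g ≈ g′ → f ⊕ g ≈ f′ ⊕ g′
⊕-cong f≈f′ g≈g′ n m = cong₂ _+_ (f≈f′ n m) (g≈g′ n m)

∑antidiag : ℕ → (ℕ → ℕ → ℕ) → ℕ
∑antidiag n F = ∑< (suc n) (λ i → F i (n ∸ i))

∑antidiag-cong : ∀ n {F G : ℕ → ℕ → ℕ} → (∀ i j → F i j ≡ G i j) → ∑antidiag n F ≡ ∑antidiag n G
∑antidiag-cong n F≗G = ∑<-cong (suc n) (λ i _ → F≗G i (n ∸ i))

∑antidiag-comm : ∀ n (F : ℕ → ℕ → ℕ) → ∑antidiag n F ≡ ∑antidiag n (λ i j → F j i)
∑antidiag-comm n F = begin
  ∑< (suc n) (λ i → F i (n ∸ i))             ≡⟨ ∑<-reverse n (λ i → F i (n ∸ i)) ⟨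
  ∑< (suc n) (λ i → F (n ∸ i) (n ∸ (n ∸ i))) ≡⟨ ∑<-cong (suc n) (λ i i≤n →
                                                   cong (F (n ∸ i)) (m∸[m∸n]≡n (s≤s⁻¹ i≤n))) ⟩
  ∑< (suc n) (λ i → F (n ∸ i) i)             ∎
  where open ≡-Reasoning

∑antidiag-assoc : ∀ n (F : ℕ → ℕ → ℕ → ℕ) →
  ∑antidiag n (λ i i₃ → ∑antidiag i (λ i₁ i₂ → F i₁ i₂ i₃)) ≡ ∑antidiag n (λ i₁ r → ∑antidiag r (F i₁))
∑antidiag-assoc n F = begin
  ∑< (suc n) (λ i → ∑< (suc i) (λ i₁ → F i₁ (i ∸ i₁) (n ∸ i)))
    ≡⟨ ∑<-triangle n (λ i₁ i → F i₁ (i ∸ i₁) (n ∸ i)) ⟩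
  ∑< (suc n) (λ i₁ → ∑< (suc (n ∸ i₁)) (λ u → F i₁ (i₁ + u ∸ i₁) (n ∸ (i₁ + u))))
    ≡⟨ ∑<-cong (suc n) (λ i₁ _ → ∑<-cong (suc (n ∸ i₁)) (λ u _ →
         cong₂ (F i₁) (m+n∸m≡n i₁ u) (sym (∸-+-assoc n i₁ u)))) ⟩
  ∑< (suc n) (λ i₁ → ∑< (suc (n ∸ i₁)) (λ u → F i₁ u (n ∸ i₁ ∸ u)))
    ∎
  where open ≡-Reasoning

sumTo≡∑< : ∀ n f → sumTo n f ≡ ∑< (suc n) f
sumTo≡∑< n f = trans (cong sum (map-applyUpTo id f (suc n))) (sum-applyUpTo (suc n) f)

⊛-∑antidiag : ∀ f g n m → (f ⊛ g) n m ≡ ∑antidiag n (λ i i′ → ∑antidiag m (λ j j′ → f i j * g i′ j′))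
⊛-∑antidiag f g n m = trans (sumTo≡∑< n (λ i → sumTo m (λ j → f i j * g (n ∸ i) (m ∸ j))))
  (∑<-cong (suc n) (λ i _ → sumTo≡∑< m (λ j → f i j * g (n ∸ i) (m ∸ j))))

*-distribˡ-⊛ : ∀ c f g n m →
  c * (f ⊛ g) n m ≡ ∑antidiag n (λ i i′ → ∑antidiag m (λ j j′ → c * (f i j * g i′ j′)))
*-distribˡ-⊛ c f g n m = trans (cong (c *_) (⊛-∑antidiag f g n m))
  (trans (*-distribˡ-∑< (suc n) c (λ i → ∑antidiag m (λ j j′ → f i j * g (n ∸ i) j′)))
    (∑<-cong (suc n) (λ i _ → *-distribˡ-∑< (suc m) c (λ j → f i j * g (n ∸ i) (m ∸ j)))))

*-distribʳ-⊛ : ∀ c f g n m →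
  (f ⊛ g) n m * c ≡ ∑antidiag n (λ i i′ → ∑antidiag m (λ j j′ → f i j * g i′ j′ * c))
*-distribʳ-⊛ c f g n m = trans (cong (_* c) (⊛-∑antidiag f g n m))
  (trans (*-distribʳ-∑< (suc n) c (λ i → ∑antidiag m (λ j j′ → f i j * g (n ∸ i) j′)))
    (∑<-cong (suc n) (λ i _ → *-distribʳ-∑< (suc m) c (λ j → f i j * g (n ∸ i) (m ∸ j)))))

⊛-cong : ∀ {f f′ g g′} → f ≈ f′ → g ≈ g′ → f ⊛ g ≈ f′ ⊛ g′
⊛-cong {f} {f′} {g} {g′} f≈f′ g≈g′ n m = begin
  (f ⊛ g) n m    ≡⟨ ⊛-∑antidiag f g n m ⟩
  _              ≡⟨ ∑antidiag-cong n (λ i i′ → ∑antidiag-cong m (λ j j′ →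
                      cong₂ _*_ (f≈f′ i j) (g≈g′ i′ j′))) ⟩
  _              ≡⟨ ⊛-∑antidiag f′ g′ n m ⟨
  (f′ ⊛ g′) n m  ∎
  where open ≡-Reasoning

⊛-comm : ∀ f g → f ⊛ g ≈ g ⊛ f
⊛-comm f g n m = begin
  (f ⊛ g) n m
    ≡⟨ ⊛-∑antidiag f g n m ⟩
  ∑antidiag n (λ i i′ → ∑antidiag m (λ j j′ → f i j * g i′ j′))
    ≡⟨ ∑antidiag-comm n (λ i i′ → ∑antidiag m (λ j j′ → f i j * g i′ j′)) ⟩
  ∑antidiag n (λ i i′ → ∑antidiag m (λ j j′ → f i′ j * g i j′))
    ≡⟨ ∑antidiag-cong n (λ i i′ → ∑antidiag-comm m (λ j j′ → f i′ j * g i j′)) ⟩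
  ∑antidiag n (λ i i′ → ∑antidiag m (λ j j′ → f i′ j′ * g i j))
    ≡⟨ ∑antidiag-cong n (λ i i′ → ∑antidiag-cong m (λ j j′ → *-comm (f i′ j′) (g i j))) ⟩
  ∑antidiag n (λ i i′ → ∑antidiag m (λ j j′ → g i j * f i′ j′))
    ≡⟨ ⊛-∑antidiag g f n m ⟨
  (g ⊛ f) n m
    ∎
  where open ≡-Reasoning

⊛-assoc : ∀ f g h → (f ⊛ g) ⊛ h ≈ f ⊛ (g ⊛ h)
⊛-assoc f g h n m = begin
  ((f ⊛ g) ⊛ h) n m
    ≡⟨ ⊛-∑antidiag (f ⊛ g) h n m ⟩
  ∑antidiag n (λ i i₃ → ∑antidiag m (λ j j₃ → (f ⊛ g) i j * h i₃ j₃))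
    ≡⟨ ∑antidiag-cong n (λ i i₃ → ∑antidiag-cong m (λ j j₃ →
         trans (*-distribʳ-⊛ (h i₃ j₃) f g i j)
               (∑antidiag-cong i (λ i₁ i₂ → ∑antidiag-cong j (λ j₁ j₂ → *-assoc (f i₁ j₁) (g i₂ j₂) (h i₃ j₃)))))) ⟩
  ∑antidiag n (λ i i₃ → ∑antidiag m (λ j j₃ →
    ∑antidiag i (λ i₁ i₂ → ∑antidiag j (λ j₁ j₂ → F i₁ i₂ i₃ j₁ j₂ j₃))))
    ≡⟨ ∑antidiag-cong n (λ i i₃ → ∑<-comm (suc m) (suc i) (λ j i₁ →
         ∑antidiag j (λ j₁ j₂ → F i₁ (i ∸ i₁) i₃ j₁ j₂ (m ∸ j)))) ⟩
  ∑antidiag n (λ i i₃ → ∑antidiag i (λ i₁ i₂ →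
    ∑antidiag m (λ j j₃ → ∑antidiag j (λ j₁ j₂ → F i₁ i₂ i₃ j₁ j₂ j₃))))
    ≡⟨ ∑antidiag-assoc n (λ i₁ i₂ i₃ → ∑antidiag m (λ j j₃ → ∑antidiag j (λ j₁ j₂ → F i₁ i₂ i₃ j₁ j₂ j₃))) ⟩
  ∑antidiag n (λ i₁ r → ∑antidiag r (λ i₂ i₃ →
    ∑antidiag m (λ j j₃ → ∑antidiag j (λ j₁ j₂ → F i₁ i₂ i₃ j₁ j₂ j₃))))
    ≡⟨ ∑antidiag-cong n (λ i₁ r → ∑antidiag-cong r (λ i₂ i₃ → ∑antidiag-assoc m (F i₁ i₂ i₃))) ⟩
  ∑antidiag n (λ i₁ r → ∑antidiag r (λ i₂ i₃ →
    ∑antidiag m (λ j₁ s → ∑antidiag s (λ j₂ j₃ → F i₁ i₂ i₃ j₁ j₂ j₃))))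
    ≡⟨ ∑antidiag-cong n (λ i₁ r → ∑<-comm (suc r) (suc m) (λ i₂ j₁ →
         ∑antidiag (m ∸ j₁) (λ j₂ j₃ → F i₁ i₂ (r ∸ i₂) j₁ j₂ j₃))) ⟩
  ∑antidiag n (λ i₁ r → ∑antidiag m (λ j₁ s →
    ∑antidiag r (λ i₂ i₃ → ∑antidiag s (λ j₂ j₃ → F i₁ i₂ i₃ j₁ j₂ j₃))))
    ≡⟨ ∑antidiag-cong n (λ i₁ r → ∑antidiag-cong m (λ j₁ s → *-distribˡ-⊛ (f i₁ j₁) g h r s)) ⟨
  ∑antidiag n (λ i₁ r → ∑antidiag m (λ j₁ s → f i₁ j₁ * (g ⊛ h) r s))
    ≡⟨ ⊛-∑antidiag f (g ⊛ h) n m ⟨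
  (f ⊛ (g ⊛ h)) n m
    ∎
  where
  open ≡-Reasoning
  F : ℕ → ℕ → ℕ → ℕ → ℕ → ℕ → ℕ
  F i₁ i₂ i₃ j₁ j₂ j₃ = f i₁ j₁ * (g i₂ j₂ * h i₃ j₃)

⊛-distribˡ-⊕ : ∀ f g h → f ⊛ (g ⊕ h) ≈ f ⊛ g ⊕ f ⊛ h
⊛-distribˡ-⊕ f g h n m = begin
  (f ⊛ (g ⊕ h)) n m
    ≡⟨ ⊛-∑antidiag f (g ⊕ h) n m ⟩
  ∑antidiag n (λ i i′ → ∑antidiag m (λ j j′ → f i j * (g i′ j′ + h i′ j′)))
    ≡⟨ ∑antidiag-cong n (λ i i′ → trans
         (∑antidiag-cong m (λ j j′ → *-distribˡ-+ (f i j) (g i′ j′) (h i′ j′)))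
         (∑<-+ (suc m) (λ j → f i j * g i′ (m ∸ j)) (λ j → f i j * h i′ (m ∸ j)))) ⟩
  ∑antidiag n (λ i i′ → ∑antidiag m (λ j j′ → f i j * g i′ j′) + ∑antidiag m (λ j j′ → f i j * h i′ j′))
    ≡⟨ ∑<-+ (suc n) (λ i → ∑antidiag m (λ j j′ → f i j * g (n ∸ i) j′))
                    (λ i → ∑antidiag m (λ j j′ → f i j * h (n ∸ i) j′)) ⟩
  ∑antidiag n (λ i i′ → ∑antidiag m (λ j j′ → f i j * g i′ j′))
    + ∑antidiag n (λ i i′ → ∑antidiag m (λ j j′ → f i j * h i′ j′))
    ≡⟨ cong₂ _+_ (⊛-∑antidiag f g n m) (⊛-∑antidiag f h n m) ⟨
  (f ⊛ g) n m + (f ⊛ h) n m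
    ∎
  where open ≡-Reasoning

⊛-distribʳ-⊕ : ∀ f g h → (g ⊕ h) ⊛ f ≈ g ⊛ f ⊕ h ⊛ f
⊛-distribʳ-⊕ f g h n m = trans (⊛-comm (g ⊕ h) f n m)
  (trans (⊛-distribˡ-⊕ f g h n m) (cong₂ _+_ (⊛-comm f g n m) (⊛-comm f h n m)))

scale-⊛ : ∀ c f g n m → (scale c f ⊛ g) n m ≡ c * (f ⊛ g) n m
scale-⊛ c f g n m = trans (⊛-∑antidiag (scale c f) g n m) (sym (trans (*-distribˡ-⊛ c f g n m)
  (∑antidiag-cong n (λ i i′ → ∑antidiag-cong m (λ j j′ → sym (*-assoc c (f i j) (g i′ j′)))))))

mono-⊛ : ∀ i j f n m →
  (mono i j ⊛ f) n m ≡ (if (i <ᵇ suc n) ∧ (j <ᵇ suc m) then f (n ∸ i) (m ∸ j) else 0)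
mono-⊛ i j f n m = begin
  (mono i j ⊛ f) n m
    ≡⟨ ⊛-∑antidiag (mono i j) f n m ⟩
  ∑antidiag n (λ i′ n′ → ∑antidiag m (λ j′ m′ → mono i j i′ j′ * f n′ m′))
    ≡⟨ ∑<-cong (suc n) (λ i′ _ → row i′) ⟩
  ∑< (suc n) (λ i′ → if i′ ≡ᵇ i then (if j <ᵇ suc m then f (n ∸ i′) (m ∸ j) else 0) else 0)
    ≡⟨ ∑<-delta (suc n) i (λ i′ → if j <ᵇ suc m then f (n ∸ i′) (m ∸ j) else 0) ⟩
  (if i <ᵇ suc n then (if j <ᵇ suc m then f (n ∸ i) (m ∸ j) else 0) else 0)
    ≡⟨ if-∧ (i <ᵇ suc n) ⟨
  (if (i <ᵇ suc n) ∧ (j <ᵇ suc m) then f (n ∸ i) (m ∸ j) else 0)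
    ∎
  where
  open ≡-Reasoning
  row : ∀ i′ → ∑antidiag m (λ j′ m′ → mono i j i′ j′ * f (n ∸ i′) m′)
             ≡ (if i′ ≡ᵇ i then (if j <ᵇ suc m then f (n ∸ i′) (m ∸ j) else 0) else 0)
  row i′ with i′ ≡ᵇ i
  ... | true  = trans (∑<-cong (suc m) (λ j′ _ → indicator-* (j′ ≡ᵇ j) (f (n ∸ i′) (m ∸ j′))))
                      (∑<-delta (suc m) j (λ j′ → f (n ∸ i′) (m ∸ j′)))
  ... | false = ∑<-zero (suc m) (λ _ _ → refl)

⊛-identityˡ : ∀ f → one ⊛ f ≈ f
⊛-identityˡ f = mono-⊛ 0 0 f

⊛-identityʳ : ∀ f → f ⊛ one ≈ f
⊛-identityʳ f = ≈-trans (⊛-comm f one) (⊛-identityˡ f)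

⊛-isCommutativeMonoid : IsCommutativeMonoid _≈_ _⊛_ one
⊛-isCommutativeMonoid = record
  { isMonoid = record
    { isSemigroup = record
      { isMagma = record { isEquivalence = ≈-isEquivalence ; ∙-cong = ⊛-cong }
      ; assoc   = ⊛-assoc
      }
    ; identity = ⊛-identityˡ , ⊛-identityʳ
    }
  ; comm = ⊛-comm
  }

⊛-commutativeMonoid : CommutativeMonoid 0ℓ 0ℓ
⊛-commutativeMonoid = record { isCommutativeMonoid = ⊛-isCommutativeMonoid }

mono-split : ∀ i e e′ → mono 1 e ⊛ mono i e′ ≈ mono (suc i) (e + e′)
mono-split i e e′ zero    m = mono-⊛ 1 e (mono i e′) 0 m
mono-split i e e′ (suc n) m = trans (mono-⊛ 1 e (mono i e′) (suc n) m) shifted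
  where
  shifted : (if e <ᵇ suc m then (if (n ≡ᵇ i) ∧ (m ∸ e ≡ᵇ e′) then 1 else 0) else 0)
          ≡ (if (n ≡ᵇ i) ∧ (m ≡ᵇ e + e′) then 1 else 0)
  shifted rewrite ≡ᵇ-sym m (e + e′) | +-≡ᵇ e e′ m with e <ᵇ suc m
  ... | true  rewrite ≡ᵇ-sym e′ (m ∸ e) = refl
  ... | false rewrite ∧-zeroʳ (n ≡ᵇ i) = refl

mono-⊛-rotate : ∀ g e i e′ h → g ⊛ (mono 1 e ⊛ (mono i e′ ⊛ h)) ≈ mono (suc i) (e + e′) ⊛ (g ⊛ h)
mono-⊛-rotate g e i e′ h = begin
  g ⊛ (mono 1 e ⊛ (mono i e′ ⊛ h))  ≈⟨ ⊛-cong (≈-refl {g}) (≈-sym (⊛-assoc (mono 1 e) (mono i e′) h)) ⟩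
  g ⊛ ((mono 1 e ⊛ mono i e′) ⊛ h)  ≈⟨ ⊛-cong (≈-refl {g}) (⊛-cong (mono-split i e e′) (≈-refl {h})) ⟩
  g ⊛ (mono (suc i) (e + e′) ⊛ h)   ≈⟨ x∙yz≈y∙xz g (mono (suc i) (e + e′)) h ⟩
  mono (suc i) (e + e′) ⊛ (g ⊛ h)   ∎
  where
  open import Relation.Binary.Reasoning.Setoid ≈-setoid
  open import Algebra.Properties.CommutativeSemigroup
    (CommutativeMonoid.commutativeSemigroup ⊛-commutativeMonoid) using (x∙yz≈y∙xz)

prodS-++ : ∀ xs ys → prodS (xs ++ ys) ≈ prodS xs ⊛ prodS ys
prodS-++ []       ys = ≈-sym (⊛-identityˡ (prodS ys))
prodS-++ (x ∷ xs) ys = ≈-trans (⊛-cong (≈-refl {x}) (prodS-++ xs ys)) (≈-sym (⊛-assoc x (prodS xs) (prodS ys)))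


-- Linear equations whose coefficient is divisible by x

XDivisible : Series → Set
XDivisible f = ∀ m → f 0 m ≡ 0

⊛-cong-below : ∀ {f g h n} → XDivisible f → (∀ n′ → n′ < n → ∀ m → g n′ m ≡ h n′ m) →
               ∀ m → (f ⊛ g) n m ≡ (f ⊛ h) n m
⊛-cong-below {f} {g} {h} {n} f₀≡0 g≡h m = begin
  (f ⊛ g) n m
    ≡⟨ ⊛-∑antidiag f g n m ⟩
  ∑< (suc n) (λ i → ∑antidiag m (λ j j′ → f i j * g (n ∸ i) j′))
    ≡⟨ ∑<-cong (suc n) row ⟩
  ∑< (suc n) (λ i → ∑antidiag m (λ j j′ → f i j * h (n ∸ i) j′))
    ≡⟨ ⊛-∑antidiag f h n m ⟨
  (f ⊛ h) n m
    ∎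
  where
  open ≡-Reasoning
  row : ∀ i → i < suc n → ∑antidiag m (λ j j′ → f i j * g (n ∸ i) j′)
                        ≡ ∑antidiag m (λ j j′ → f i j * h (n ∸ i) j′)
  row zero    _       = ∑antidiag-cong m (λ j j′ →
    trans (cong (_* g n j′) (f₀≡0 j)) (sym (cong (_* h n j′) (f₀≡0 j))))
  row (suc i) i<1+n = ∑antidiag-cong m (λ j j′ →
    cong (f (suc i) j *_) (g≡h (n ∸ suc i) (∸-monoʳ-< z<s (s≤s⁻¹ i<1+n)) j′))

⊛-vanishes-below : ∀ {f g d} → XDivisible f → (∀ n′ → n′ < d → ∀ m → g n′ m ≡ 0) →
                   ∀ n → n ≤ d → ∀ m → (f ⊛ g) n m ≡ 0
⊛-vanishes-below {f} {g} {d} f₀≡0 g≡0 n n≤d m =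
  trans (⊛-∑antidiag f g n m) (∑<-zero (suc n) row)
  where
  row : ∀ i → i < suc n → ∑antidiag m (λ j j′ → f i j * g (n ∸ i) j′) ≡ 0
  row zero    _     = ∑<-zero (suc m) (λ j _ → cong (_* g n (m ∸ j)) (f₀≡0 j))
  row (suc i) i<1+n = ∑<-zero (suc m) (λ j _ → trans
    (cong (f (suc i) j *_) (g≡0 (n ∸ suc i) (<-≤-trans (∸-monoʳ-< z<s (s≤s⁻¹ i<1+n)) n≤d) (m ∸ j)))
    (*-zeroʳ (f (suc i) j)))

⊛-degree0 : ∀ f → XDivisible f → ∀ g m → (f ⊛ g) 0 m ≡ 0
⊛-degree0 f f₀≡0 g = ⊛-vanishes-below {f} {g} {0} f₀≡0 (λ _ ()) 0 z≤n

⊛-∑< : ∀ f T (g : ℕ → Series) n m →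
  (f ⊛ (λ n′ m′ → ∑< T (λ t → g t n′ m′))) n m ≡ ∑< T (λ t → (f ⊛ g t) n m)
⊛-∑< f T g n m = begin
  (f ⊛ (λ n′ m′ → ∑< T (λ t → g t n′ m′))) n m
    ≡⟨ ⊛-∑antidiag f (λ n′ m′ → ∑< T (λ t → g t n′ m′)) n m ⟩
  ∑antidiag n (λ i i′ → ∑antidiag m (λ j j′ → f i j * ∑< T (λ t → g t i′ j′)))
    ≡⟨ ∑antidiag-cong n (λ i i′ → ∑antidiag-cong m (λ j j′ → *-distribˡ-∑< T (f i j) (λ t → g t i′ j′))) ⟩
  ∑antidiag n (λ i i′ → ∑antidiag m (λ j j′ → ∑< T (λ t → f i j * g t i′ j′)))
    ≡⟨ ∑antidiag-cong n (λ i i′ → ∑<-comm (suc m) T (λ j t → f i j * g t i′ (m ∸ j))) ⟩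
  ∑antidiag n (λ i i′ → ∑< T (λ t → ∑antidiag m (λ j j′ → f i j * g t i′ j′)))
    ≡⟨ ∑<-comm (suc n) T (λ i t → ∑antidiag m (λ j j′ → f i j * g t (n ∸ i) j′)) ⟩
  ∑< T (λ t → ∑antidiag n (λ i i′ → ∑antidiag m (λ j j′ → f i j * g t i′ j′)))
    ≡⟨ ∑<-cong T (λ t _ → ⊛-∑antidiag f (g t) n m) ⟨
  ∑< T (λ t → (f ⊛ g t) n m)
    ∎
  where open ≡-Reasoning

fixpoint-unique : ∀ {f g h r} → XDivisible f → g ≈ f ⊛ g ⊕ r → h ≈ f ⊛ h ⊕ r → g ≈ h
fixpoint-unique {f} {g} {h} {r} f₀≡0 g-fix h-fix n = <-rec (λ n → ∀ m → g n m ≡ h n m) step n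
  where
  step : ∀ n → (∀ {n′} → n′ < n → ∀ m → g n′ m ≡ h n′ m) → ∀ m → g n m ≡ h n m
  step n ih m = begin
    g n m               ≡⟨ g-fix n m ⟩
    (f ⊛ g) n m + r n m ≡⟨ cong (_+ r n m) (⊛-cong-below {f} {g} {h} f₀≡0 (λ _ → ih) m) ⟩
    (f ⊛ h) n m + r n m ≡⟨ h-fix n m ⟨
    h n m               ∎
    where open ≡-Reasoning

pow-vanishes : ∀ {f} → XDivisible f → ∀ t n → n < t → ∀ m → pow f t n m ≡ 0
pow-vanishes {f} f₀≡0 (suc t) n n<1+t =
  ⊛-vanishes-below {f} {pow f t} {t} f₀≡0 (pow-vanishes f₀≡0 t) n (s≤s⁻¹ n<1+t)

geom-unfold : ∀ {f} → XDivisible f → geom f ≈ f ⊛ geom f ⊕ one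
geom-unfold {f} f₀≡0 n m = begin
  geom f n m                                      ≡⟨ geom≡partial n m n ≤-refl ⟩
  partial n m                                     ≡⟨ ∑<-vanishing-tail (λ t → pow f t n m) (n≤1+n (suc n))
                                                       (λ t n<t _ → pow-vanishes f₀≡0 t n n<t m) ⟨
  one n m + ∑< (suc n) (λ t → (f ⊛ pow f t) n m)  ≡⟨ cong (one n m +_) (⊛-∑< f (suc n) (pow f) n m) ⟨
  one n m + (f ⊛ partial) n m                     ≡⟨ cong (one n m +_) (⊛-cong-below {f} {partial} {geom f} f₀≡0
                                                       (λ n′ n′<n m′ → sym (geom≡partial n′ m′ n (<⇒≤ n′<n))) m) ⟩
  one n m + (f ⊛ geom f) n m                      ≡⟨ +-comm (one n m) _ ⟩
  (f ⊛ geom f) n m + one n m                      ∎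
  where
  open ≡-Reasoning
  partial : Series
  partial n′ m′ = ∑< (suc n) (λ t → pow f t n′ m′)
  geom≡partial : ∀ n′ m′ N → n′ ≤ N → geom f n′ m′ ≡ ∑< (suc N) (λ t → pow f t n′ m′)
  geom≡partial n′ m′ N n′≤N = trans (sumTo≡∑< n′ (λ t → pow f t n′ m′))
    (sym (∑<-vanishing-tail (λ t → pow f t n′ m′) (s≤s n′≤N) (λ t n′<t _ → pow-vanishes f₀≡0 t n′ n′<t m′)))

fixpoint⇒≈geom⊛ : ∀ {f g r} → XDivisible f → g ≈ f ⊛ g ⊕ r → g ≈ geom f ⊛ r
fixpoint⇒≈geom⊛ {f} {g} {r} f₀≡0 g-fix = fixpoint-unique {f} {g} {geom f ⊛ r} {r} f₀≡0 g-fix (begin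
  geom f ⊛ r                  ≈⟨ ⊛-cong (geom-unfold f₀≡0) ≈-refl ⟩
  (f ⊛ geom f ⊕ one) ⊛ r      ≈⟨ ⊛-distribʳ-⊕ r (f ⊛ geom f) one ⟩
  (f ⊛ geom f) ⊛ r ⊕ one ⊛ r  ≈⟨ ⊕-cong (⊛-assoc f (geom f) r) (⊛-identityˡ r) ⟩
  f ⊛ (geom f ⊛ r) ⊕ r        ∎)
  where open import Relation.Binary.Reasoning.Setoid ≈-setoid


xTerm : ℕ → Series
xTerm i = scale i (mono 1 0)

qTerm : ℕ → Series
qTerm j = mono 1 1 ⊛ qint j

xFactor : ℕ → Series
xFactor i = geom (xTerm i)

qFactor : ℕ → Series
qFactor j = geom (qTerm j)

mono-divisible : ∀ i e → XDivisible (mono (suc i) e)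
mono-divisible i e m = refl

xTerm-divisible : ∀ i → XDivisible (xTerm i)
xTerm-divisible i m = *-zeroʳ i

qTerm-divisible : ∀ j → XDivisible (qTerm j)
qTerm-divisible j = mono-⊛ 1 1 (qint j) 0

xTerm-⊛ : ∀ i f n m → (xTerm i ⊛ f) (suc n) m ≡ i * f n m
xTerm-⊛ i f n m = trans (scale-⊛ i (mono 1 0) f (suc n) m) (cong (i *_) (mono-⊛ 1 0 f (suc n) m))

qint-⊛ : ∀ j f n m → (qint j ⊛ f) n m ≡ ∑< j (λ l → if l <ᵇ suc m then f n (m ∸ l) else 0)
qint-⊛ j f n m = begin
  (qint j ⊛ f) n m
    ≡⟨ ⊛-∑antidiag (qint j) f n m ⟩
  ∑< (suc m) (λ l → qint j 0 l * f n (m ∸ l)) + ∑< n (λ _ → ∑< (suc m) (λ _ → 0))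
    ≡⟨ cong₂ _+_ (∑<-cong (suc m) (λ l _ → indicator-* (l <ᵇ j) (f n (m ∸ l))))
                 (∑<-zero n (λ _ _ → ∑<-zero (suc m) (λ _ _ → refl))) ⟩
  ∑< (suc m) (λ l → if l <ᵇ j then f n (m ∸ l) else 0) + 0
    ≡⟨ +-identityʳ _ ⟩
  ∑< (suc m) (λ l → if l <ᵇ j then f n (m ∸ l) else 0)
    ≡⟨ ∑<-truncate (suc m) j (λ l → f n (m ∸ l)) ⟩
  ∑< (suc m ⊓ j) (λ l → f n (m ∸ l))
    ≡⟨ cong (λ c → ∑< c (λ l → f n (m ∸ l))) (⊓-comm (suc m) j) ⟩
  ∑< (j ⊓ suc m) (λ l → f n (m ∸ l))
    ≡⟨ ∑<-truncate j (suc m) (λ l → f n (m ∸ l)) ⟨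
  ∑< j (λ l → if l <ᵇ suc m then f n (m ∸ l) else 0)
    ∎
  where open ≡-Reasoning

qTerm-⊛ : ∀ j f n m → (qTerm j ⊛ f) (suc n) m ≡ ∑< j (λ l → if suc l ≤ᵇ m then f n (m ∸ suc l) else 0)
qTerm-⊛ j f n m = trans (⊛-assoc (mono 1 1) (qint j) f (suc n) m)
  (trans (mono-⊛ 1 1 (qint j ⊛ f) (suc n) m) (shift m))
  where
  shift : ∀ m → (if 1 <ᵇ suc m then (qint j ⊛ f) n (m ∸ 1) else 0)
              ≡ ∑< j (λ l → if suc l ≤ᵇ m then f n (m ∸ suc l) else 0)
  shift zero    = sym (∑<-zero j (λ _ _ → refl))
  shift (suc m) = qint-⊛ j f n m

geom-qTerm0 : geom (qTerm 0) ≈ one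
geom-qTerm0 n m = trans (geom-unfold {qTerm 0} (qTerm-divisible 0) n m) (cong (_+ one n m) (vanish n))
  where
  vanish : ∀ n → (qTerm 0 ⊛ geom (qTerm 0)) n m ≡ 0
  vanish zero    = ⊛-degree0 (qTerm 0) (qTerm-divisible 0) (geom (qTerm 0)) m
  vanish (suc n) = qTerm-⊛ 0 (geom (qTerm 0)) n m

prodS-qFactor0-++ : ∀ Fs Gs → prodS (qFactor 0 ∷ (Fs ++ Gs)) ≈ prodS Fs ⊛ prodS Gs
prodS-qFactor0-++ Fs Gs =
  ≈-trans (⊛-cong geom-qTerm0 (≈-refl {prodS (Fs ++ Gs)})) (≈-trans (⊛-identityˡ _) (prodS-++ Fs Gs))

range : ℕ → ℕ → List ℕ
range s zero    = []
range s (suc c) = s ∷ range (suc s) c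

applyUpTo≡range : ∀ s c {g : ℕ → ℕ} → (∀ i → g i ≡ s + i) → applyUpTo g c ≡ range s c
applyUpTo≡range s zero    g≗s+ = refl
applyUpTo≡range s (suc c) g≗s+ = cong₂ _∷_ (trans (g≗s+ 0) (+-identityʳ s))
  (applyUpTo≡range (suc s) c (λ i → trans (g≗s+ (suc i)) (+-suc s i)))

map-+-upTo : ∀ s c → map (s +_) (upTo c) ≡ range s c
map-+-upTo s c = trans (map-applyUpTo id (s +_) c) (applyUpTo≡range s c (λ i → refl))


-- Counting canonical words by their first letter

count : ∀ {A : Set} → (A → Bool) → List A → ℕ
count p xs = length (filterᵇ p xs)

count-++ : ∀ {A : Set} (p : A → Bool) xs ys → count p (xs ++ ys) ≡ count p xs + count p ys
count-++ p xs ys = trans (cong length (filter-++ (T? ∘ p) xs ys)) (length-++ (filterᵇ p xs))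

count-map : ∀ {A B : Set} (p : B → Bool) (f : A → B) xs → count p (map f xs) ≡ count (p ∘ f) xs
count-map p f []       = refl
count-map p f (x ∷ xs) with p (f x)
... | true  = cong suc (count-map p f xs)
... | false = count-map p f xs

count-cong : ∀ {A : Set} {p q : A → Bool} → (∀ x → p x ≡ q x) → ∀ xs → count p xs ≡ count q xs
count-cong         p≗q []       = refl
count-cong {p = p} {q} p≗q (x ∷ xs) with p x | q x | p≗q x
... | true  | .true  | refl = cong suc (count-cong p≗q xs)
... | false | .false | refl = count-cong p≗q xs

count-false : ∀ {A : Set} (xs : List A) → count (λ _ → false) xs ≡ 0
count-false []       = refl
count-false (x ∷ xs) = count-false xs

count-if : ∀ {A : Set} c (p : A → Bool) xs → count (λ x → if c then p x else false) xs ≡ (if c then count p xs else 0)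
count-if true  p xs = refl
count-if false p xs = count-false xs

count-filterᵇ : ∀ {A : Set} (p q : A → Bool) xs → count q (filterᵇ p xs) ≡ count (λ x → p x ∧ q x) xs
count-filterᵇ p q []       = refl
count-filterᵇ p q (x ∷ xs) with p x
... | false = count-filterᵇ p q xs
... | true with q x
...   | true  = cong suc (count-filterᵇ p q xs)
...   | false = count-filterᵇ p q xs

#words : ℕ → ℕ → (List ℕ → Bool) → ℕ
#words k n p = count p (words k n)

count-prefixed : ∀ (p : List ℕ → Bool) W L →
  count p (concatMap (λ x → map (x ∷_) W) L) ≡ sum (map (λ x → count (p ∘ (x ∷_)) W) L)
count-prefixed p W []      = refl
count-prefixed p W (x ∷ L) = trans (count-++ p (map (x ∷_) W) (concatMap (λ x → map (x ∷_) W) L))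
  (cong₂ _+_ (count-map p (x ∷_) W) (count-prefixed p W L))

#words-suc : ∀ k n p → #words k (suc n) p ≡ ∑< k (λ i → #words k n (p ∘ (suc i ∷_)))
#words-suc k n p = begin
  count p (concatMap (λ x → map (x ∷_) (words k n)) (map suc (upTo k)))
    ≡⟨ count-prefixed p (words k n) (map suc (upTo k)) ⟩
  sum (map F (map suc (upTo k)))
    ≡⟨ cong sum (trans (cong (map F) (map-applyUpTo id suc k)) (map-applyUpTo suc F k)) ⟩
  sum (applyUpTo (F ∘ suc) k)
    ≡⟨ sum-applyUpTo k (F ∘ suc) ⟩
  ∑< k (F ∘ suc)
    ∎
  where
  open ≡-Reasoning
  F : ℕ → ℕ
  F x = #words k n (p ∘ (x ∷_))

#words-split : ∀ k j n p → j < k → (∀ i w → j < i → p (suc i ∷ w) ≡ false) →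
  #words k (suc n) p ≡ ∑< j (λ i → #words k n (p ∘ (suc i ∷_))) + #words k n (p ∘ (suc j ∷_))
#words-split k j n p j<k invalid = begin
  #words k (suc n) p ≡⟨ #words-suc k n p ⟩
  ∑< k F             ≡⟨ ∑<-vanishing-tail F j<k (λ i j<i _ → trans
                          (count-cong (λ w → invalid i w j<i) (words k n)) (count-false (words k n))) ⟩
  ∑< (suc j) F       ≡⟨ ∑<-snoc j F ⟩
  ∑< j F + F j       ∎
  where
  open ≡-Reasoning
  F : ℕ → ℕ
  F i = #words k n (p ∘ (suc i ∷_))

rgsFrom-old : ∀ {j i} w → i < j → rgsFrom j (suc i ∷ w) ≡ rgsFrom j w
rgsFrom-old w i<j = cong₂ _∧_ (T⇒≡true (<⇒<ᵇ (m<n⇒m<1+n i<j)))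
                              (cong (λ mx → rgsFrom mx w) (m≥n⇒m⊔n≡m i<j))

rgsFrom-new : ∀ j w → rgsFrom j (suc j ∷ w) ≡ rgsFrom (suc j) w
rgsFrom-new j w = cong₂ _∧_ (T⇒≡true (<⇒<ᵇ (n<1+n j)))
                            (cong (λ mx → rgsFrom mx w) (m≤n⇒m⊔n≡n (n≤1+n j)))

rgsFrom-invalid : ∀ {j i} w → j < i → rgsFrom j (suc i ∷ w) ≡ false
rgsFrom-invalid {j} {i} w j<i =
  cong (_∧ rgsFrom (j ⊔ suc i) w) (¬T⇒≡false (<⇒≱ j<i ∘ s≤s⁻¹ ∘ <ᵇ⇒< i (suc j)))

-- completes k j w: appending w to a canonical word with maximum j gives one with exactly k blocks.
-- completesSumming is used for prefixes with maximum mx < a ≤ k, where that condition is just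
-- occurs k w; it also asks the letters of w before the record a to sum to m.
completes : ℕ → ℕ → List ℕ → Bool
completes k j w = rgsFrom j w ∧ ((j ≡ᵇ k) ∨ occurs k w)

completesSumming : ℕ → ℕ → ℕ → ℕ → List ℕ → Bool
completesSumming k a mx m w = (rgsFrom mx w ∧ occurs k w) ∧ (sumelements a w ≡ᵇ m)

completes-old : ∀ {k j i} w → i < j → j ≤ k → completes k j (suc i ∷ w) ≡ completes k j w
completes-old {k} {j} {i} w i<j j≤k rewrite rgsFrom-old w i<j with m≤n⇒m<n∨m≡n j≤k
... | inj₁ j<k  rewrite ≢⇒≡ᵇ-false (<⇒≢ j<k) | ≢⇒≡ᵇ-false (<⇒≢ (≤-<-trans i<j j<k)) = refl
... | inj₂ refl rewrite ≡ᵇ-refl j = refl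

completes-new : ∀ {k j} w → j < k → completes k j (suc j ∷ w) ≡ completes k (suc j) w
completes-new {k} {j} w j<k rewrite rgsFrom-new j w | ≢⇒≡ᵇ-false (<⇒≢ j<k) = refl

completes-invalid : ∀ {k j i} w → j < i → completes k j (suc i ∷ w) ≡ false
completes-invalid w j<i rewrite rgsFrom-invalid w j<i = refl

completesSumming-cons : ∀ {k a mx mx′ x} m w → rgsFrom mx (x ∷ w) ≡ rgsFrom mx′ w → x < a → a ≤ k →
  completesSumming k a mx m (x ∷ w) ≡ (if x <ᵇ suc m then completesSumming k a mx′ (m ∸ x) w else false)
completesSumming-cons {k} {a} {mx} {mx′} {x} m w rgs x<a a≤k
  rewrite rgs | ≢⇒≡ᵇ-false (<⇒≢ (<-≤-trans x<a a≤k)) | ≢⇒≡ᵇ-false (<⇒≢ x<a)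
        | +-≡ᵇ x (sumelements a w) m with x <ᵇ suc m
... | true  = refl
... | false = ∧-zeroʳ _

completesSumming-last : ∀ k mx m w →
  completesSumming k (suc mx) mx m (suc mx ∷ w) ≡ completes k (suc mx) w ∧ (0 ≡ᵇ m)
completesSumming-last k mx m w rewrite rgsFrom-new mx w | ≡ᵇ-refl mx = refl

completesSumming-invalid : ∀ {k a mx i} m w → mx < i → completesSumming k a mx m (suc i ∷ w) ≡ false
completesSumming-invalid m w mx<i rewrite rgsFrom-invalid w mx<i = refl

-- Only q⁰ occurs: Completions continue a word in which the record a has already appeared.
Completions : ℕ → ℕ → Series
Completions k j n m = #words k n (λ w → completes k j w ∧ (0 ≡ᵇ m))

Sumelements : ℕ → ℕ → ℕ → Series
Sumelements k a mx n m = #words k n (completesSumming k a mx m)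

Completions-old-letters : ∀ k j n m → j ≤ k →
  ∑< j (λ i → #words k n (λ w → completes k j (suc i ∷ w) ∧ (0 ≡ᵇ m))) ≡ j * Completions k j n m
Completions-old-letters k j n m j≤k = trans
  (∑<-cong j (λ i i<j → count-cong (λ w → cong (_∧ (0 ≡ᵇ m)) (completes-old w i<j j≤k)) (words k n)))
  (∑<-const j (Completions k j n m))

Completions-step : ∀ k j → j < k → Completions k j ≈ xTerm j ⊛ Completions k j ⊕ mono 1 0 ⊛ Completions k (suc j)
Completions-step k j j<k zero m = trans (empty-incomplete m) (sym (cong₂ _+_
  (⊛-degree0 (xTerm j) (xTerm-divisible j) (Completions k j) m)
  (⊛-degree0 (mono 1 0) (mono-divisible 0 0) (Completions k (suc j)) m)))
  where
  empty-incomplete : ∀ m → Completions k j 0 m ≡ 0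
  empty-incomplete m rewrite ≢⇒≡ᵇ-false (<⇒≢ j<k) = refl
Completions-step k j j<k (suc n) m = begin
  Completions k j (suc n) m
    ≡⟨ #words-split k j n _ j<k (λ i w j<i → cong (_∧ (0 ≡ᵇ m)) (completes-invalid w j<i)) ⟩
  ∑< j (λ i → #words k n (λ w → completes k j (suc i ∷ w) ∧ (0 ≡ᵇ m)))
    + #words k n (λ w → completes k j (suc j ∷ w) ∧ (0 ≡ᵇ m))
    ≡⟨ cong₂ _+_ (Completions-old-letters k j n m (<⇒≤ j<k))
                 (count-cong (λ w → cong (_∧ (0 ≡ᵇ m)) (completes-new w j<k)) (words k n)) ⟩
  j * Completions k j n m + Completions k (suc j) n m
    ≡⟨ cong₂ _+_ (xTerm-⊛ j (Completions k j) n m) (mono-⊛ 1 0 (Completions k (suc j)) (suc n) m) ⟨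
  (xTerm j ⊛ Completions k j ⊕ mono 1 0 ⊛ Completions k (suc j)) (suc n) m
    ∎
  where open ≡-Reasoning

Completions-last : ∀ k → Completions k k ≈ xTerm k ⊛ Completions k k ⊕ one
Completions-last k zero m = trans (empty-word m)
  (sym (cong (_+ one 0 m) (⊛-degree0 (xTerm k) (xTerm-divisible k) (Completions k k) m)))
  where
  empty-word : ∀ m → Completions k k 0 m ≡ one 0 m
  empty-word zero    rewrite ≡ᵇ-refl k = refl
  empty-word (suc m) rewrite ≡ᵇ-refl k = refl
Completions-last k (suc n) m = begin
  Completions k k (suc n) m           ≡⟨ #words-suc k n _ ⟩
  _                                   ≡⟨ Completions-old-letters k k n m ≤-refl ⟩
  k * Completions k k n m             ≡⟨ +-identityʳ _ ⟨
  k * Completions k k n m + 0         ≡⟨ cong (_+ 0) (xTerm-⊛ k (Completions k k) n m) ⟨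
  (xTerm k ⊛ Completions k k) (suc n) m + one (suc n) m ∎
  where open ≡-Reasoning

Sumelements-suc : ∀ k a mx n m → mx < a → a ≤ k →
  Sumelements k a mx (suc n) m ≡
    (qTerm mx ⊛ Sumelements k a mx) (suc n) m + #words k n (completesSumming k a mx m ∘ (suc mx ∷_))
Sumelements-suc k a mx n m mx<a a≤k =
  trans (#words-split k mx n _ (<-≤-trans mx<a a≤k) (λ i w → completesSumming-invalid {k} {a} m w))
        (cong (_+ #words k n (completesSumming k a mx m ∘ (suc mx ∷_))) old-letters)
  where
  old-letters : ∑< mx (λ i → #words k n (completesSumming k a mx m ∘ (suc i ∷_)))
              ≡ (qTerm mx ⊛ Sumelements k a mx) (suc n) m
  old-letters = trans
    (∑<-cong mx (λ i i<mx → trans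
      (count-cong (λ w → completesSumming-cons m w (rgsFrom-old w i<mx) (≤-<-trans i<mx mx<a) a≤k) (words k n))
      (count-if (i <ᵇ m) (completesSumming k a mx (m ∸ suc i)) (words k n))))
    (sym (qTerm-⊛ mx (Sumelements k a mx) n m))

Sumelements-step : ∀ k a mx → suc mx < a → a ≤ k →
  Sumelements k a mx ≈ qTerm mx ⊛ Sumelements k a mx ⊕ mono 1 (suc mx) ⊛ Sumelements k a (suc mx)
Sumelements-step k a mx 1+mx<a a≤k zero m = sym (cong₂ _+_
  (⊛-degree0 (qTerm mx) (qTerm-divisible mx) (Sumelements k a mx) m)
  (⊛-degree0 (mono 1 (suc mx)) (mono-divisible 0 (suc mx)) (Sumelements k a (suc mx)) m))
Sumelements-step k a mx 1+mx<a a≤k (suc n) m =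
  trans (Sumelements-suc k a mx n m (<-trans (n<1+n mx) 1+mx<a) a≤k)
        (cong ((qTerm mx ⊛ Sumelements k a mx) (suc n) m +_) (trans
          (count-cong (λ w → completesSumming-cons m w (rgsFrom-new mx w) 1+mx<a a≤k) (words k n))
          (trans (count-if (mx <ᵇ m) (completesSumming k a (suc mx) (m ∸ suc mx)) (words k n))
                 (sym (mono-⊛ 1 (suc mx) (Sumelements k a (suc mx)) (suc n) m)))))

Sumelements-last : ∀ k mx → suc mx ≤ k →
  Sumelements k (suc mx) mx ≈ qTerm mx ⊛ Sumelements k (suc mx) mx ⊕ mono 1 0 ⊛ Completions k (suc mx)
Sumelements-last k mx mx<k zero m = sym (cong₂ _+_
  (⊛-degree0 (qTerm mx) (qTerm-divisible mx) (Sumelements k (suc mx) mx) m)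
  (⊛-degree0 (mono 1 0) (mono-divisible 0 0) (Completions k (suc mx)) m))
Sumelements-last k mx mx<k (suc n) m =
  trans (Sumelements-suc k (suc mx) mx n m (n<1+n mx) mx<k)
        (cong ((qTerm mx ⊛ Sumelements k (suc mx) mx) (suc n) m +_) (trans
          (count-cong (completesSumming-last k mx m) (words k n))
          (sym (mono-⊛ 1 0 (Completions k (suc mx)) (suc n) m))))


-- Solving the recurrences

Completions-solution : ∀ {k} d j → d + j ≡ k →
  Completions k j ≈ mono d 0 ⊛ prodS (map xFactor (range j (suc d)))
Completions-solution zero j refl =
  ≈-trans (fixpoint⇒≈geom⊛ (xTerm-divisible j) (Completions-last j)) (≈-sym (⊛-identityˡ _))
Completions-solution (suc d) j refl = begin
  Completions (suc d + j) j
    ≈⟨ fixpoint⇒≈geom⊛ (xTerm-divisible j) (Completions-step (suc d + j) j (s≤s (m≤n+m j d))) ⟩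
  xFactor j ⊛ (mono 1 0 ⊛ Completions (suc d + j) (suc j))
    ≈⟨ ⊛-cong (≈-refl {xFactor j}) (⊛-cong (≈-refl {mono 1 0}) (Completions-solution d (suc j) (+-suc d j))) ⟩
  xFactor j ⊛ (mono 1 0 ⊛ (mono d 0 ⊛ prodS (map xFactor (range (suc j) (suc d)))))
    ≈⟨ mono-⊛-rotate (xFactor j) 0 d 0 (prodS (map xFactor (range (suc j) (suc d)))) ⟩
  mono (suc d) 0 ⊛ prodS (map xFactor (range j (suc (suc d))))
    ∎
  where open import Relation.Binary.Reasoning.Setoid ≈-setoid

recordSum : ℕ → ℕ → ℕ
recordSum s zero    = 0
recordSum s (suc d) = suc s + recordSum (suc s) d

-- d and d′ count the records after mx below and above a; the records below a each add
-- their value to sumelements_a, which gives the exponent recordSum mx d.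
Sumelements-solution : ∀ {k a} d d′ mx → d + suc mx ≡ a → d′ + a ≡ k →
  Sumelements k a mx ≈ mono (suc (d + d′)) (recordSum mx d)
                       ⊛ prodS (map qFactor (range mx (suc d)) ++ map xFactor (range a (suc d′)))
Sumelements-solution zero d′ mx refl refl = begin
  Sumelements (d′ + suc mx) (suc mx) mx
    ≈⟨ fixpoint⇒≈geom⊛ (qTerm-divisible mx) (Sumelements-last (d′ + suc mx) mx (m≤n+m (suc mx) d′)) ⟩
  qFactor mx ⊛ (mono 1 0 ⊛ Completions (d′ + suc mx) (suc mx))
    ≈⟨ ⊛-cong (≈-refl {qFactor mx}) (⊛-cong (≈-refl {mono 1 0}) (Completions-solution d′ (suc mx) refl)) ⟩
  qFactor mx ⊛ (mono 1 0 ⊛ (mono d′ 0 ⊛ prodS Xs))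
    ≈⟨ mono-⊛-rotate (qFactor mx) 0 d′ 0 (prodS Xs) ⟩
  mono (suc d′) 0 ⊛ prodS (qFactor mx ∷ Xs)
    ∎
  where
  open import Relation.Binary.Reasoning.Setoid ≈-setoid
  Xs : List Series
  Xs = map xFactor (range (suc mx) (suc d′))
Sumelements-solution {k} {a} (suc d) d′ mx refl refl = begin
  Sumelements k a mx
    ≈⟨ fixpoint⇒≈geom⊛ (qTerm-divisible mx) (Sumelements-step k a mx (s≤s (m≤n+m (suc mx) d)) (m≤n+m a d′)) ⟩
  qFactor mx ⊛ (mono 1 (suc mx) ⊛ Sumelements k a (suc mx))
    ≈⟨ ⊛-cong (≈-refl {qFactor mx}) (⊛-cong (≈-refl {mono 1 (suc mx)})
         (Sumelements-solution d d′ (suc mx) (+-suc d (suc mx)) refl)) ⟩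
  qFactor mx ⊛ (mono 1 (suc mx) ⊛ (mono (suc (d + d′)) (recordSum (suc mx) d) ⊛ prodS Fs))
    ≈⟨ mono-⊛-rotate (qFactor mx) (suc mx) (suc (d + d′)) (recordSum (suc mx) d) (prodS Fs) ⟩
  mono (suc (suc d + d′)) (recordSum mx (suc d)) ⊛ prodS (qFactor mx ∷ Fs)
    ∎
  where
  open import Relation.Binary.Reasoning.Setoid ≈-setoid
  Fs : List Series
  Fs = map qFactor (range (suc mx) (suc d)) ++ map xFactor (range a (suc d′))

recordSum*2 : ∀ s d → recordSum s d * 2 ≡ d * (suc d + s * 2)
recordSum*2 s zero    = refl
recordSum*2 s (suc d) = begin
  (suc s + recordSum (suc s) d) * 2    ≡⟨ *-distribʳ-+ 2 (suc s) (recordSum (suc s) d) ⟩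
  suc s * 2 + recordSum (suc s) d * 2  ≡⟨ cong (suc s * 2 +_) (recordSum*2 (suc s) d) ⟩
  suc s * 2 + d * (suc d + suc s * 2)  ≡⟨ expand s d ⟩
  suc d * (suc (suc d) + s * 2)        ∎
  where
  open ≡-Reasoning
  open +-*-Solver
  expand : ∀ s d → suc s * 2 + d * (suc d + suc s * 2) ≡ suc d * (suc (suc d) + s * 2)
  expand = solve 2 (λ s d → (con 1 :+ s) :* con 2 :+ d :* (con 1 :+ d :+ (con 1 :+ s) :* con 2)
                          := (con 1 :+ d) :* (con 2 :+ d :+ s :* con 2)) refl

triangular≡recordSum : ∀ c → (suc c * c) / 2 ≡ recordSum 0 c
triangular≡recordSum c = trans (cong (_/ 2) double) (m*n/n≡m (recordSum 0 c) 2)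
  where
  double : suc c * c ≡ recordSum 0 c * 2
  double = sym (trans (recordSum*2 0 c) (trans (cong (c *_) (+-identityʳ (suc c))) (*-comm c (suc c))))

theorem1 : (k a : ℕ) → 1 ≤ k → 1 ≤ a → a ≤ k → (n m : ℕ) →
    Pka k a n m ≡
      (mono k ((a * (a ∸ 1)) / 2)
        ⊛ (prodS (map (λ j → geom (mono 1 1 ⊛ qint j)) (map suc (upTo (a ∸ 1))))
        ⊛ prodS (map (λ i → geom (scale i (mono 1 0))) (map (λ t → a + t) (upTo (suc k ∸ a)))))) n m
theorem1 k (suc c) _ (s≤s z≤n) c<k n m = begin
  Pka k (suc c) n m
    ≡⟨ count-filterᵇ (inPnk k) (λ w → sumelements (suc c) w ≡ᵇ m) (words k n) ⟩
  Sumelements k (suc c) 0 n m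
    ≡⟨ Sumelements-solution c d 0 (+-comm c 1) (m∸n+n≡m c<k) n m ⟩
  (mono (suc (c + d)) (recordSum 0 c)
     ⊛ prodS (qFactor 0 ∷ (map qFactor (range 1 c) ++ map xFactor (range (suc c) (suc d))))) n m
    ≡⟨ ⊛-cong (≈-refl {mono (suc (c + d)) (recordSum 0 c)}) (prodS-qFactor0-++ (map qFactor (range 1 c)) _) n m ⟩
  rhs (suc (c + d)) (recordSum 0 c) (range 1 c) (range (suc c) (suc d))
    ≡⟨ cong₂ (λ K e → rhs K e (range 1 c) (range (suc c) (suc d)))
             (m+[n∸m]≡n c<k) (sym (triangular≡recordSum c)) ⟩
  rhs k ((suc c * c) / 2) (range 1 c) (range (suc c) (suc d))
    ≡⟨ cong₂ (rhs k ((suc c * c) / 2)) (sym (map-+-upTo 1 c))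
         (trans (cong (range (suc c)) (sym (+-∸-assoc 1 c<k))) (sym (map-+-upTo (suc c) (k ∸ c)))) ⟩
  rhs k ((suc c * c) / 2) (map suc (upTo c)) (map (suc c +_) (upTo (k ∸ c)))
    ∎
  where
  open ≡-Reasoning
  d : ℕ
  d = k ∸ suc c
  rhs : ℕ → ℕ → List ℕ → List ℕ → ℕ
  rhs K e Js Is = (mono K e ⊛ (prodS (map qFactor Js) ⊛ prodS (map xFactor Is))) n m
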